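{- There is a first-order formula $\psi(x,y,z)$ in the vocabulary of rings $\tau_{\text{ring}}=(+,\cdot,1,0)$ such that for every finite commutative ring $R$, every $e\in\mathcal B(R)$ and all $r,s\in R$: $(R,e,r,s)\models\psi$ if and only if $s$ is the projection of $r$ onto $e\cdot R$ (with respect to the decomposition $R=\bigoplus_{e'\in\mathcal B(R)}e'\cdot R$).
   Context: For a finite commutative ring $R$, $\mathcal B(R)$ is the unique set of pairwise orthogonal ($xy=0$) idempotent ($x^2=x$) elements of $R$ such that $e\cdot R$ is a local ring (unique maximal ideal) for each $e\in\mathcal B(R)$, $\sum_{e\in\mathcal B(R)}e=1$, and $R=\bigoplus_{e\in\mathcal B(R)}e\cdot R$ as a direct sum of rings. -}

module Defs where

open import Level using (0ℓ)
open import Algebra.Bundles using (CommutativeRing)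
open import Data.Nat using (ℕ)
open import Data.Fin using (Fin)
open import Data.List using (List; length; lookup; foldr)
open import Data.List.Relation.Unary.All using (All)
open import Data.List.Relation.Unary.Any using (Any)
open import Data.List.Relation.Unary.AllPairs using (AllPairs)
open import Data.Product using (Σ; ∃; ∃-syntax; _×_; _,_)
open import Data.Sum using (_⊎_)
open import Data.Unit using (⊤)
open import Data.Empty using (⊥)
open import Relation.Nullary using (¬_)
open import Relation.Unary using (Pred)
open import Function.Bundles using (Inverse)
import Relation.Binary.PropositionalEquality as ≡

data Term (n : ℕ) : Set where
  var  : Fin n → Term n
  zero′ : Term n
  one′  : Term n
  _⊕_  : Term n → Term n → Term n
  _⊗_  : Term n → Term n → Term n

data Formula (n : ℕ) : Set where
  _≐_  : Term n → Term n → Formula n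
  ⊤′   : Formula n
  ⊥′   : Formula n
  ¬′_  : Formula n → Formula n
  _∧′_ : Formula n → Formula n → Formula n
  _∨′_ : Formula n → Formula n → Formula n
  _⇒′_ : Formula n → Formula n → Formula n
  ∀′   : Formula (ℕ.suc n) → Formula n
  ∃′   : Formula (ℕ.suc n) → Formula n

module _ (R : CommutativeRing 0ℓ 0ℓ) where
  open CommutativeRing R

  _∷ₐ_ : {n : ℕ} → Carrier → (Fin n → Carrier) → Fin (ℕ.suc n) → Carrier
  (a ∷ₐ ρ) Fin.zero    = a
  (a ∷ₐ ρ) (Fin.suc i) = ρ i

  ⟦_⟧ₜ : {n : ℕ} → Term n → (Fin n → Carrier) → Carrier
  ⟦ var i ⟧ₜ ρ = ρ i
  ⟦ zero′ ⟧ₜ ρ = 0#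
  ⟦ one′ ⟧ₜ ρ = 1#
  ⟦ t ⊕ u ⟧ₜ ρ = ⟦ t ⟧ₜ ρ + ⟦ u ⟧ₜ ρ
  ⟦ t ⊗ u ⟧ₜ ρ = ⟦ t ⟧ₜ ρ * ⟦ u ⟧ₜ ρ

  Sat : {n : ℕ} → Formula n → (Fin n → Carrier) → Set
  Sat (t ≐ u) ρ = ⟦ t ⟧ₜ ρ ≈ ⟦ u ⟧ₜ ρ
  Sat ⊤′ ρ = ⊤
  Sat ⊥′ ρ = ⊥
  Sat (¬′ φ) ρ = ¬ Sat φ ρ
  Sat (φ ∧′ ψ) ρ = Sat φ ρ × Sat ψ ρ
  Sat (φ ∨′ ψ) ρ = Sat φ ρ ⊎ Sat ψ ρ
  Sat (φ ⇒′ ψ) ρ = Sat φ ρ → Sat ψ ρ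
  Sat (∀′ φ) ρ = (a : Carrier) → Sat φ (a ∷ₐ ρ)
  Sat (∃′ φ) ρ = Σ Carrier (λ a → Sat φ (a ∷ₐ ρ))

  assign3 : Carrier → Carrier → Carrier → Fin 3 → Carrier
  assign3 a b c Fin.zero = a
  assign3 a b c (Fin.suc Fin.zero) = b
  assign3 a b c (Fin.suc (Fin.suc Fin.zero)) = c

  IsFinite : Set
  IsFinite = ∃[ n ] Inverse setoid (≡.setoid (Fin n))

  _∈_·R : Carrier → Carrier → Set
  x ∈ e ·R = ∃[ t ] x ≈ e * t

  -- Ideals of the ring e·R (whose identity is e), as predicates on R.
  record IsIdealOf (e : Carrier) (I : Pred Carrier 0ℓ) : Set where
    field
      resp   : ∀ {x y} → x ≈ y → I x → I y
      sub    : ∀ x → I x → x ∈ e ·R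
      has0   : I 0#
      +-closed : ∀ x y → I x → I y → I (x + y)
      neg-closed : ∀ x → I x → I (- x)
      mul-closed : ∀ a x → a ∈ e ·R → I x → I (a * x)

  IsMaximalIdealOf : Carrier → Pred Carrier 0ℓ → Set₁
  IsMaximalIdealOf e M =
    IsIdealOf e M × ¬ M e ×
    (∀ (J : Pred Carrier 0ℓ) → IsIdealOf e J → (∀ x → M x → J x) → ¬ J e → ∀ x → J x → M x)

  IsLocal : Carrier → Set₁
  IsLocal e =
    Σ (Pred Carrier 0ℓ) λ M → IsMaximalIdealOf e M ×
      (∀ M′ → IsMaximalIdealOf e M′ → ∀ x → (M x → M′ x) × (M′ x → M x))

  sumF : {n : ℕ} → (Fin n → Carrier) → Carrier
  sumF {ℕ.zero} c = 0#
  sumF {ℕ.suc n} c = c Fin.zero + sumF (λ i → c (Fin.suc i))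

  IsDecomposition : (E : List Carrier) → Carrier → (Fin (length E) → Carrier) → Set
  IsDecomposition E r c = (∀ i → c i ∈ lookup E i ·R) × sumF c ≈ r

  -- E is 𝓑(R): a set (no repetitions) of pairwise orthogonal idempotents,
  -- each e·R local, summing to 1, and R = ⊕_{e∈E} e·R (internal direct sum:
  -- every r decomposes uniquely).
  record Is𝓑 (E : List Carrier) : Set₁ where
    field
      distinct    : AllPairs (λ a b → ¬ a ≈ b) E
      idempotent  : All (λ a → a * a ≈ a) E
      orthogonal  : AllPairs (λ a b → a * b ≈ 0#) E
      local       : All IsLocal E
      sum-one     : foldr _+_ 0# E ≈ 1#
      decomp-exists : ∀ r → ∃[ c ] IsDecomposition E r c
      decomp-unique : ∀ r c d → IsDecomposition E r c → IsDecomposition E r d → ∀ i → c i ≈ d i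

  _∈ₗ_ : Carrier → List Carrier → Set
  e ∈ₗ E = Any (e ≈_) E

  IsProjection : List Carrier → Carrier → Carrier → Carrier → Set
  IsProjection E e r s =
    ∃[ c ] IsDecomposition E r c × (∀ i → lookup E i ≈ e → c i ≈ s)

-- The projection of r onto e·R is e * r: since the idempotents of 𝓑(R) sum to 1,
-- r = Σ_{e′ ∈ 𝓑(R)} e′ * r is a decomposition of r along 𝓑(R), and by uniqueness of
-- decompositions its e-component is the projection. So ψ(x, y, z) is the atomic
-- formula z = x · y.
module Submission where

open import Defs
open import Level using (0ℓ)
open import Algebra.Bundles using (CommutativeRing)
open import Data.List using (List; []; _∷_; length; lookup; foldr)
open import Data.List.Relation.Unary.Any using (index)
open import Data.List.Relation.Unary.Any.Properties using (lookup-index)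
open import Data.Product using (Σ; _,_)
open import Data.Fin using (Fin; zero; suc)
open import Function.Bundles using (_⇔_; mk⇔)
import Function.Properties.Equivalence as ⇔

isProjectionFormula : Formula 3
isProjectionFormula = var z ≐ (var x ⊗ var y)
  where
  x y z : Fin 3
  x = zero
  y = suc zero
  z = suc (suc zero)

module _ (R : CommutativeRing 0ℓ 0ℓ) where
  open CommutativeRing R
  open import Relation.Binary.Reasoning.Setoid setoid

  sumF-lookup-*ʳ : ∀ E r → sumF R (λ i → lookup E i * r) ≈ foldr _+_ 0# E * r
  sumF-lookup-*ʳ []      r = sym (zeroˡ r)
  sumF-lookup-*ʳ (e ∷ E) r = begin
    e * r + sumF R (λ i → lookup E i * r) ≈⟨ +-congˡ (sumF-lookup-*ʳ E r) ⟩
    e * r + foldr _+_ 0# E * r            ≈⟨ distribʳ r e (foldr _+_ 0# E) ⟨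
    (e + foldr _+_ 0# E) * r              ∎

  isDecomposition-lookup-* : ∀ E → foldr _+_ 0# E ≈ 1# →
    ∀ r → IsDecomposition R E r (λ i → lookup E i * r)
  isDecomposition-lookup-* E ΣE≈1 r = (λ i → r , refl) , (begin
    sumF R (λ i → lookup E i * r) ≈⟨ sumF-lookup-*ʳ E r ⟩
    foldr _+_ 0# E * r            ≈⟨ *-congʳ ΣE≈1 ⟩
    1# * r                        ≈⟨ *-identityˡ r ⟩
    r                             ∎)

  isProjection⇔≈* : ∀ {E} → Is𝓑 R E → ∀ {e} → _∈ₗ_ R e E →
    ∀ r s → IsProjection R E e r s ⇔ s ≈ e * r
  isProjection⇔≈* {E} 𝓑 {e} e∈E r s = mk⇔ to from
    where
    open Is𝓑 𝓑
    j : Fin (length E)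
    j = index e∈E

    e≈Eⱼ : e ≈ lookup E j
    e≈Eⱼ = lookup-index e∈E

    byIdempotents : IsDecomposition R E r (λ i → lookup E i * r)
    byIdempotents = isDecomposition-lookup-* E sum-one r

    to : IsProjection R E e r s → s ≈ e * r
    to (c , c-decomp , cₑ≈s) = begin
      s              ≈⟨ cₑ≈s j (sym e≈Eⱼ) ⟨
      c j            ≈⟨ decomp-unique r c _ c-decomp byIdempotents j ⟩
      lookup E j * r ≈⟨ *-congʳ e≈Eⱼ ⟨
      e * r          ∎

    from : s ≈ e * r → IsProjection R E e r s
    from s≈er = _ , byIdempotents , λ i Eᵢ≈e → trans (*-congʳ Eᵢ≈e) (sym s≈er)

lemma3p4 : Σ (Formula 3) λ ψ →
    (R : CommutativeRing 0ℓ 0ℓ) → IsFinite R →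
    (E : List (CommutativeRing.Carrier R)) → Is𝓑 R E →
    (e : CommutativeRing.Carrier R) → _∈ₗ_ R e E →
    (r s : CommutativeRing.Carrier R) →
    Sat R ψ (assign3 R e r s) ⇔ IsProjection R E e r s
lemma3p4 = isProjectionFormula , λ R _ E 𝓑 e e∈E r s →
  ⇔.sym (isProjection⇔≈* R 𝓑 e∈E r s)
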